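{- Let $M$ be a $\lambda\mathbb{A}$-term, $n\in\mathbb{N}$, $\vec x=x_1,\dots,x_n$ distinct variables with $\mathrm{FV}(M)\subseteq\vec x$, and $\vec a=a_1,\dots,a_n\in\mathbb{A}$. Then: (i) $[\![M]\!]^{\vec x}=\langle\vec R,\mathtt{Load}\ i_1;\dots;\mathtt{Load}\ i_n;P,[]\rangle$ for some $\mathbb{A}_\varnothing$-valued registers $\vec R$, program $P$ and indices $i_1,\dots,i_n\in\mathbb{N}$; (ii) if $m<n$ then $[\![M]\!]^{\vec x}@[a_1,\dots,a_m]\twoheadrightarrow_h\mathrm{stuck}$; (iii) for every variable $y\notin\vec x$ with $\mathrm{FV}(M)\subseteq\{y\}\cup\vec x$ and every $b\in\mathbb{A}$: $[\![M]\!]^{y,\vec x}@[b]\equiv^{ae}[\![M[y:=\underline{b}]]\!]^{\vec x}$; (iv) in particular, if $y\notin\vec x$ and $y\notin\mathrm{FV}(M)$ then $[\![M]\!]^{y,\vec x}@[b]\equiv^{ae}[\![M]\!]^{\vec x}$; (v) for every permutation $\sigma$ of $\{1,\dots,n\}$: $[\![M]\!]^{\vec x}@[a_1,\dots,a_n]\equiv^{ae}[\![M]\!]^{x_{\sigma(1)},\dots,x_{\sigma(n)}}@[a_{\sigma(1)},\dots,a_{\sigma(n)}]$.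
   Context: Addressing machines. Fix a countable set $\mathbb{A}$ of addresses and a symbol $\varnothing\notin\mathbb{A}$; $\mathbb{A}_\varnothing=\mathbb{A}\cup\{\varnothing\}$. A tape is a finite list of elements of $\mathbb{A}$; $a::T$ has head $a$ and tail $T$, $T@T'$ is concatenation. A program is a finite list of instructions generated by $P::=\mathtt{Load}\ i;P\mid A$, $A::=\mathtt{App}(i,j,k);A\mid C$, $C::=\mathtt{Call}\ i\mid\varepsilon$ ($i,j,k\in\mathbb{N}$). For $r\in\mathbb{N}$, $I\subseteq\{0,\dots,r-1\}$, $I\models^r P$ is the least relation such that: $I\models^r\varepsilon$; $I\models^r\mathtt{Call}\ i$ if $i\in I$; $I\models^r\mathtt{App}(i,j,k);A$ if $i,j\in I$ and either ($k<r$ and $I\cup\{k\}\models^r A$) or ($k\ge r$ and $I\models^r A$); $I\models^r\mathtt{Load}\ i;P$ if either ($i<r$ and $I\cup\{i\}\models^r P$) or ($i\ge r$ and $I\models^r P$). An addressing machine is $M=\langle R_0,\dots,R_{r-1},P,T\rangle$ with registers in $\mathbb{A}_\varnothing$, $P$ valid w.r.t. the registers ($\{i<r\mid R_i\ne\varnothing\}\models^r P$), and a tape $T$; $\mathcal{M}$ is the set of all of them. $\vec R[R_i:=a]$ replaces $R_i$ by $a$ if $i<r$, is $\vec R$ if $i\ge r$. $M$ is stuck if $M.P=\mathtt{Load}\ i;P'$ and $M.T=[]$. Fix a bijection $\#:\mathcal{M}\to\mathbb{A}$ with inverse $\#^{ -1}$; $M@T'=\langle M.\vec R,M.P,M.T@T'\rangle$;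 $a\cdot b=\#(\#^{ -1}(a)@[b])$. Head reduction: $\langle\vec R,\mathtt{Load}\ i;P,a::T\rangle\to_h\langle\vec R[R_i:=a],P,T\rangle$, $\langle\vec R,\mathtt{App}(i,j,k);P,T\rangle\to_h\langle\vec R[R_k:=R_i\cdot R_j],P,T\rangle$, $\langle\vec R,\mathtt{Call}\ i,T\rangle\to_h\#^{ -1}(R_i)@T$; $\twoheadrightarrow_h$ reflexive-transitive closure; "$M\twoheadrightarrow_h\mathrm{stuck}$" means $M\twoheadrightarrow_h N$ for some stuck $N$. Induced relations: for a relation $\equiv_R$ on $\mathcal{M}$, $a\simeq_R b$ iff $\#^{ -1}(a)\equiv_R\#^{ -1}(b)$; on $\mathbb{A}_\varnothing$, both $\varnothing$ or both addresses related; componentwise on tuples/tapes of equal length; $M=_R N$ iff $M.\vec R\simeq_R N.\vec R$, $M.P=N.P$, $M.T\simeq_R N.T$. Applicative equivalence $\equiv^{ae}$ is the least equivalence relation on $\mathcal{M}$ such that: (1) $M\twoheadrightarrow_h Z=^{ae}N$ implies $M\equiv^{ae}N$; (2) if $M\twoheadrightarrow_h\mathrm{stuck}$, $N\twoheadrightarrow_h\mathrm{stuck}$ and $M@[a]\equiv^{ae}N@[a]$ for all $a\in\mathbb{A}$, then $M\equiv^{ae}N$; $=^{ae}$ is induced by $\equiv^{ae}$. $\lambda\mathbb{A}$-terms are $\lambda$-terms possibly containing constants $\underline{a}$ ($a\in\mathbb{A}$), with $\underline{a}[x:=N]=\underline{a}$, modulo $\alpha$-conversion. For a list $\vec x=x_1,\dots,x_n$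 of distinct variables containing $\mathrm{FV}(M)$: $[\![x_i]\!]^{\vec x}=\langle\varnothing,(\mathtt{Load}\ 1)^{i-1};\mathtt{Load}\ 0;(\mathtt{Load}\ 1)^{n-i};\mathtt{Call}\ 0,[]\rangle$ (one register; loading into index $1$ discards the value); $[\![\underline{a}]\!]^{\vec x}=\langle a,(\mathtt{Load}\ 1)^n;\mathtt{Call}\ 0,[]\rangle$; $[\![MN]\!]^{\vec x}=\langle\varnothing^n,\#[\![M]\!]^{\vec x},\#[\![N]\!]^{\vec x},\varnothing,\mathtt{Apply}_n,[]\rangle$ ($n+3$ registers) with $\mathtt{Apply}_n=\mathtt{Load}\ 0;\dots;\mathtt{Load}\ (n-1);\mathtt{App}(n,0,n);\dots;\mathtt{App}(n,n-1,n);\mathtt{App}(n+1,0,n+1);\dots;\mathtt{App}(n+1,n-1,n+1);\mathtt{App}(n,n+1,n+2);\mathtt{Call}\ (n+2)$; $[\![\lambda y.M]\!]^{\vec x}=[\![M]\!]^{\vec x,y}$ ($y\notin\vec x$ after renaming). -}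

module Defs where

open import Data.Nat using (ℕ; zero; suc; _+_; _∸_; _<_; _≤_; _≟_; s≤s; z≤n)
open import Data.Nat.Properties using (+-suc; +-identityʳ; m≤m+n; ≤-trans; n<1+n; m<n⇒m<1+n)
open import Data.Bool using (Bool; true; false; _∧_; T)
import Data.Bool
open import Data.Unit using (tt)
open import Data.Maybe using (Maybe; just; nothing; is-just)
open import Data.List using (List; []; _∷_; _++_; map; replicate)
open import Data.Fin using (Fin; zero; suc; toℕ; fromℕ; inject₁; lower₁)
open import Data.Product using (Σ; ∃; _×_; _,_)
open import Data.Sum using (_⊎_; inj₁; inj₂; [_,_]′)
import Data.Sum as Sum
open import Function.Bundles using (_↔_)
open import Relation.Nullary using (yes; no)
open import Relation.Binary.PropositionalEquality
open import Relation.Binary.Construct.Closure.ReflexiveTransitive using (Star)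
open import Data.List.Relation.Binary.Pointwise using (Pointwise)
import Data.Maybe.Relation.Binary.Pointwise as MP

-- Instructions and programs (a program is a list of instructions; the
-- grammar  P ::= Load i;P | A,  A ::= App(i,j,k);A | C,  C ::= Call i | ε
-- is enforced by the validity judgement below, exactly as |=^r).

data Instr : Set where
  load : ℕ → Instr
  app  : ℕ → ℕ → ℕ → Instr
  call : ℕ → Instr

Program : Set
Program = List Instr

-- A set I ⊆ {0,…,r-1} is represented by its characteristic list of
-- length r.  'has I i' is i ∈ I (false for i ≥ r), 'ins I k' is
-- I ∪ {k} if k < r, and I if k ≥ r.
has : List Bool → ℕ → Bool
has []      _       = false
has (b ∷ I) zero    = b
has (b ∷ I) (suc i) = has I i

ins : List Bool → ℕ → List Bool
ins []      _       = []
ins (b ∷ I) zero    = true ∷ I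
ins (b ∷ I) (suc k) = b ∷ ins I k

validC : List Bool → Program → Bool
validC I []             = true
validC I (call i ∷ [])  = has I i
validC I _              = false

validA : List Bool → Program → Bool
validA I (app i j k ∷ A) = has I i ∧ (has I j ∧ validA (ins I k) A)
validA I P               = validC I P

validP : List Bool → Program → Bool
validP I (load i ∷ P) = validP (ins I i) P
validP I P            = validA I P

-- Addressing machines over a set A of addresses (nothing = ∅).

record Machine (A : Set) : Set where
  constructor mk
  field
    regs  : List (Maybe A)
    prog  : Program
    tape  : List A
    valid : T (validP (map is-just regs) prog)
open Machine public

record Addressing : Set₁ where
  field
    Addr      : Set
    countable : Addr ↔ ℕ
    code      : Machine Addr → Addr
    decode    : Addr → Machine Addr
    decode∘code : ∀ M → decode (code M) ≡ M
    code∘decode : ∀ a → code (decode a) ≡ a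

range : ℕ → ℕ → List ℕ
range k zero    = []
range k (suc m) = k ∷ range (suc k) m

appsPart : ℕ → Program
appsPart n = map (λ j → app n j n) (range 0 n)
          ++ map (λ j → app (suc n) j (suc n)) (range 0 n)
          ++ app n (suc n) (suc (suc n)) ∷ call (suc (suc n)) ∷ []

Apply : ℕ → Program
Apply n = map load (range 0 n) ++ appsPart n

private
  skip1 : ∀ b k P → validP (b ∷ []) (replicate k (load 1) ++ P) ≡ validP (b ∷ []) P
  skip1 b zero    P = refl
  skip1 b (suc k) P = skip1 b k P

  insAt : ∀ k (b c : Bool) L → ins (replicate k b ++ c ∷ L) k ≡ replicate k b ++ true ∷ L
  insAt zero    b c L = refl
  insAt (suc k) b c L = cong (b ∷_) (insAt k b c L)

  hasAt : ∀ k (b : Bool) L → has (replicate k b ++ true ∷ L) k ≡ true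
  hasAt zero    b L = refl
  hasAt (suc k) b L = hasAt k b L

  repSnoc : ∀ k (L : List Bool) b → replicate k b ++ b ∷ L ≡ b ∷ replicate k b ++ L
  repSnoc zero    L b = refl
  repSnoc (suc k) L b = cong (b ∷_) (repSnoc k L b)

  hasRep : ∀ N L j → j < N → has (replicate N true ++ L) j ≡ true
  hasRep (suc N) L zero    p       = refl
  hasRep (suc N) L (suc j) (s≤s p) = hasRep N L j p

  insRep : ∀ N L j → j < N → ins (replicate N true ++ L) j ≡ replicate N true ++ L
  insRep (suc N) L zero    p       = refl
  insRep (suc N) L (suc j) (s≤s p) = cong (true ∷_) (insRep N L j p)

  mapRep : ∀ {A : Set} n (L : List (Maybe A)) →
           map is-just (replicate n nothing ++ L) ≡ replicate n false ++ map is-just L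
  mapRep zero    L = refl
  mapRep (suc n) L = cong (false ∷_) (mapRep n L)

  loadsLemma : ∀ k m J P →
    validP (replicate k true ++ replicate m false ++ J) (map load (range k m) ++ P)
    ≡ validP (replicate (k + m) true ++ J) P
  loadsLemma k zero J P = cong (λ x → validP (replicate x true ++ J) P) (sym (+-identityʳ k))
  loadsLemma k (suc m) J P =
    trans (cong (λ I → validP I (map load (range (suc k) m) ++ P))
                (trans (insAt k true false _) (repSnoc k _ true)))
          (trans (loadsLemma (suc k) m J P)
                 (cong (λ x → validP (replicate x true ++ J) P) (sym (+-suc k m))))

  appsLemma : ∀ I i k P k₀ m → has I i ≡ true → ins I k ≡ I →
    (∀ j → j < k₀ + m → has I j ≡ true) →
    validA I (map (λ j → app i j k) (range k₀ m) ++ P) ≡ validA I P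
  appsLemma I i k P k₀ zero    hi hk h = refl
  appsLemma I i k P k₀ (suc m) hi hk h
    rewrite hi | h k₀ (subst (k₀ <_) (sym (+-suc k₀ m)) (s≤s (m≤m+n k₀ m))) | hk
    = appsLemma I i k P (suc k₀) m hi hk (λ j p → h j (subst (j <_) (sym (+-suc k₀ m)) p))

  pvA : ∀ I n → validP I (appsPart n) ≡ validA I (appsPart n)
  pvA I zero    = refl
  pvA I (suc n) = refl

  ≤suc2 : ∀ {j n} → j < n → j < suc (suc n)
  ≤suc2 p = m<n⇒m<1+n (m<n⇒m<1+n p)

validVar : ∀ i k → T (validP (false ∷ [])
  (replicate i (load 1) ++ load 0 ∷ replicate k (load 1) ++ call 0 ∷ []))
validVar i k = subst T (sym (trans (skip1 false i _) (skip1 true k _))) tt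

validCst : ∀ n → T (validP (true ∷ []) (replicate n (load 1) ++ call 0 ∷ []))
validCst n = subst T (sym (skip1 true n _)) tt

validApply : ∀ {A : Set} n (m m′ : A) →
  T (validP (map is-just (replicate n nothing ++ just m ∷ just m′ ∷ nothing ∷ [])) (Apply n))
validApply {A} n m m′ = subst T (sym eq) tt
  where
  open ≡-Reasoning
  N = suc (suc n)
  K′ = replicate N true ++ false ∷ []
  hK : ∀ j → j < N → has K′ j ≡ true
  hK j p = hasRep N _ j p
  eq : validP (map is-just (replicate n nothing ++ just m ∷ just m′ ∷ nothing ∷ [])) (Apply n) ≡ true
  eq = begin
      validP (map is-just (replicate n nothing ++ just m ∷ just m′ ∷ nothing ∷ [])) (Apply n)
    ≡⟨ cong (λ I → validP I (Apply n)) (mapRep n (just m ∷ just m′ ∷ nothing ∷ [])) ⟩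
      validP (replicate n false ++ true ∷ true ∷ false ∷ []) (Apply n)
    ≡⟨ loadsLemma 0 n _ (appsPart n) ⟩
      validP (replicate n true ++ true ∷ true ∷ false ∷ []) (appsPart n)
    ≡⟨ cong (λ I → validP I (appsPart n))
            (trans (repSnoc n _ true) (cong (true ∷_) (repSnoc n _ true))) ⟩
      validP K′ (appsPart n)
    ≡⟨ pvA K′ n ⟩
      validA K′ (appsPart n)
    ≡⟨ appsLemma K′ n n _ 0 n (hK n (m<n⇒m<1+n (n<1+n n)))
         (insRep N _ n (m<n⇒m<1+n (n<1+n n))) (λ j p → hK j (≤suc2 p)) ⟩
      validA K′ (map (λ j → app (suc n) j (suc n)) (range 0 n)
                 ++ app n (suc n) N ∷ call N ∷ [])
    ≡⟨ appsLemma K′ (suc n) (suc n) _ 0 n (hK (suc n) (n<1+n (suc n)))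
         (insRep N _ (suc n) (n<1+n (suc n))) (λ j p → hK j (≤suc2 p)) ⟩
      has K′ n ∧ (has K′ (suc n) ∧ has (ins K′ N) N)
    ≡⟨ cong₂ (λ x y → x ∧ (y ∧ has (ins K′ N) N)) (hK n (m<n⇒m<1+n (n<1+n n))) (hK (suc n) (n<1+n (suc n))) ⟩
      has (ins K′ N) N
    ≡⟨ cong (λ I → has I N) (insAt N true false []) ⟩
      has (replicate N true ++ true ∷ []) N
    ≡⟨ hasAt N true [] ⟩
      true
    ∎

module Theory (S : Addressing) where
  open Addressing S public

  𝓜 : Set
  𝓜 = Machine Addr

  -- M @ T'   (written ⊕ since @ is reserved in Agda)
  _⊕_ : 𝓜 → List Addr → 𝓜
  M ⊕ T′ = record M { tape = tape M ++ T′ }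

  _·_ : Addr → Addr → Addr
  a · b = code (decode a ⊕ (b ∷ []))

  setReg : List (Maybe Addr) → ℕ → Maybe Addr → List (Maybe Addr)
  setReg []      _       x = []
  setReg (r ∷ R) zero    x = x ∷ R
  setReg (r ∷ R) (suc i) x = r ∷ setReg R i x

  lookupReg : List (Maybe Addr) → ℕ → Maybe Addr
  lookupReg []      _       = nothing
  lookupReg (r ∷ R) zero    = r
  lookupReg (r ∷ R) (suc i) = lookupReg R i

  infix 4 _→h_ _↠h_
  data _→h_ : 𝓜 → 𝓜 → Set where
    loadStep : ∀ {R i P a T v}
      {v′ : Data.Bool.T (validP (map is-just (setReg R i (just a))) P)} →
      mk R (load i ∷ P) (a ∷ T) v →h mk (setReg R i (just a)) P T v′
    appStep : ∀ {R i j k P T v a b}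
      {v′ : Data.Bool.T (validP (map is-just (setReg R k (just (a · b)))) P)} →
      lookupReg R i ≡ just a → lookupReg R j ≡ just b →
      mk R (app i j k ∷ P) T v →h mk (setReg R k (just (a · b))) P T v′
    callStep : ∀ {R i T v a} →
      lookupReg R i ≡ just a →
      mk R (call i ∷ []) T v →h (decode a ⊕ T)

  _↠h_ : 𝓜 → 𝓜 → Set
  _↠h_ = Star _→h_

  Stuck : 𝓜 → Set
  Stuck M = Σ ℕ λ i → Σ Program λ P → (prog M ≡ load i ∷ P) × (tape M ≡ [])

  _↠stuck : 𝓜 → Set
  M ↠stuck = Σ 𝓜 λ N → (M ↠h N) × Stuck N

  SameShape : (Addr → Addr → Set) → 𝓜 → 𝓜 → Set
  SameShape _≃_ M N =
    Pointwise (MP.Pointwise _≃_) (regs M) (regs N) × (prog M ≡ prog N)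
    × Pointwise _≃_ (tape M) (tape N)

  infix 4 _≡ae_
  data _≡ae_ : 𝓜 → 𝓜 → Set where
    ae-red   : ∀ {M Z N} → M ↠h Z →
               SameShape (λ a b → decode a ≡ae decode b) Z N → M ≡ae N
    ae-stuck : ∀ {M N} → M ↠stuck → N ↠stuck →
               (∀ a → (M ⊕ (a ∷ [])) ≡ae (N ⊕ (a ∷ []))) → M ≡ae N
    ae-refl  : ∀ {M} → M ≡ae M
    ae-sym   : ∀ {M N} → M ≡ae N → N ≡ae M
    ae-trans : ∀ {M N L} → M ≡ae N → N ≡ae L → M ≡ae L

  -- λ𝔸-terms, well scoped: Tm n = terms with free variables among the
  -- list x₁,…,xₙ (variable x_{i+1} is 'var i').  Under 'lam' the bound
  -- variable is appended at the END of the list (index n), matching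
  -- [[λy.M]]^x = [[M]]^{x,y}.

  data Tm : ℕ → Set where
    var  : ∀ {n} → Fin n → Tm n
    cst  : ∀ {n} → Addr → Tm n
    _$_  : ∀ {n} → Tm n → Tm n → Tm n
    lam  : ∀ {n} → Tm (suc n) → Tm n

  liftθ : ∀ {n m} → (Fin n → Fin m ⊎ Addr) → Fin (suc n) → Fin (suc m) ⊎ Addr
  liftθ {n} {m} θ i with n ≟ toℕ i
  ... | yes _ = inj₁ (fromℕ m)
  ... | no p  = Sum.map₁ inject₁ (θ (lower₁ i p))

  act : ∀ {n m} → (Fin n → Fin m ⊎ Addr) → Tm n → Tm m
  act θ (var i) = [ var , cst ]′ (θ i)
  act θ (cst a) = cst a
  act θ (M $ N) = act θ M $ act θ N
  act θ (lam M) = lam (act (liftθ θ) M)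

  -- M : Tm (suc n) over y,x₁,…,xₙ;  M[y := b] over x₁,…,xₙ
  _[0:=_] : ∀ {n} → Tm (suc n) → Addr → Tm n
  M [0:= b ] = act θ M
    where
    θ : ∀ {n} → Fin (suc n) → Fin n ⊎ Addr
    θ zero    = inj₂ b
    θ (suc i) = inj₁ i

  -- M over x₁,…,xₙ seen as a term over y,x₁,…,xₙ (y not free in M)
  weaken0 : ∀ {n} → Tm n → Tm (suc n)
  weaken0 = act (λ i → inj₁ (suc i))

  rename : ∀ {n m} → (Fin n → Fin m) → Tm n → Tm m
  rename ρ = act (λ i → inj₁ (ρ i))

  ⟦_⟧ : ∀ {n} → Tm n → 𝓜
  ⟦_⟧ {n} (var i) =
    mk (nothing ∷ [])
       (replicate (toℕ i) (load 1) ++ load 0 ∷ replicate (n ∸ suc (toℕ i)) (load 1) ++ call 0 ∷ [])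
       [] (validVar (toℕ i) (n ∸ suc (toℕ i)))
  ⟦_⟧ {n} (cst a) = mk (just a ∷ []) (replicate n (load 1) ++ call 0 ∷ []) [] (validCst n)
  ⟦_⟧ {n} (M $ N) =
    mk (replicate n nothing ++ just (code ⟦ M ⟧) ∷ just (code ⟦ N ⟧) ∷ nothing ∷ [])
       (Apply n) [] (validApply n (code ⟦ M ⟧) (code ⟦ N ⟧))
  ⟦_⟧ {n} (lam M) = ⟦ M ⟧

-- Running a translated term on a tape of arguments is determined by the
-- arguments alone: ⟦ var i ⟧ and ⟦ cst a ⟧ first skip or load their
-- arguments and then jump to the addressed machine, while ⟦ M $ N ⟧ loads
-- its arguments, applies both # ⟦ M ⟧ and # ⟦ N ⟧ to them and jumps to
-- ⟦ M ⟧ with the extra argument # (⟦ N ⟧ @ args).  Hence, by induction on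
-- M, the machine ⟦ M ⟧ @ as is applicatively equivalent to ⟦ act θ M ⟧ @ bs
-- whenever every variable i denotes the same address lookup as i on the
-- left and θ i on the right; abstractions are handled by rule (2), because
-- a translated term with too few arguments is stuck on a Load.  Parts
-- (iii)-(v) are instances of this simulation, and (i), (ii) follow from
-- the shape of the translated programs.
module Submission where

open import Defs
open import Data.Nat using (ℕ; suc; _<_)
open import Data.List using (List; []; _∷_; _++_; map; length; take)
open import Data.Vec using (Vec; toList; tabulate; lookup)
open import Data.Fin.Permutation using (Permutation′; _⟨$⟩ʳ_; _⟨$⟩ˡ_)
open import Data.Product using (Σ; _×_)
open import Relation.Binary.PropositionalEquality using (_≡_)

open import Data.Nat using (zero; _+_; _∸_; _⊓_; _≤_; _≟_; s≤s; z≤n)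
open import Data.Nat.Properties
  using (+-suc; +-comm; +-identityʳ; +-monoʳ-≤; m+[n∸m]≡n; m≤n⇒m⊓n≡m; m⊓n≤m;
         n≤1+n; ≤-refl; ≤-reflexive; ≤-trans; ≤-<-trans; <⇒≢)
open import Data.List using (foldl; replicate; drop)
open import Data.List.Properties
  using (length-take; take++drop≡id; length-++; length-replicate; ++-identityʳ; ++-assoc;
         map-++; map-replicate)
import Data.List.Relation.Binary.Pointwise as Pointwise
import Data.Maybe.Relation.Binary.Pointwise as MaybePointwise
open import Data.Vec using (_∷ʳ_)
open import Data.Vec.Properties using (toList-∷ʳ; length-toList; lookup∘tabulate)
open import Data.Maybe using (Maybe; just; nothing; is-just)
open import Data.Empty using (⊥-elim)
open import Data.Bool using (T)
open import Data.Bool.Properties using (T-∧)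
open import Data.Fin using (Fin; zero; suc; toℕ; fromℕ; inject₁; lower₁)
open import Data.Fin.Properties using (toℕ-fromℕ; toℕ-injective; inject₁-lower₁; toℕ<n)
open import Data.Fin.Permutation using (inverseʳ)
open import Data.Sum using (_⊎_; inj₁; inj₂; [_,_]′)
import Data.Sum as Sum
open import Data.Product using (_,_; proj₂)
open import Function using (id)
open import Function.Bundles using (Equivalence)
open import Relation.Binary.Bundles using (Setoid)
open import Relation.Binary.PropositionalEquality
open import Relation.Binary.Construct.Closure.ReflexiveTransitive using (ε; _◅_; _◅◅_)
open import Relation.Nullary using (yes; no)

validA⇒validP : ∀ I P → T (validA I P) → T (validP I P)
validA⇒validP I []              t = t
validA⇒validP I (load i ∷ P)    ()
validA⇒validP I (app i j k ∷ P) t = t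
validA⇒validP I (call i ∷ P)    t = t

validA-app : ∀ I {i j k} P → T (validA I (app i j k ∷ P)) → T (validP (ins I k) P)
validA-app I {i} {j} P t =
  validA⇒validP _ P (proj₂ (Equivalence.to T-∧ (proj₂ (Equivalence.to (T-∧ {has I i}) t))))

map-load-++ : ∀ xs ys (P : Program) → map load (xs ++ ys) ++ P ≡ map load xs ++ map load ys ++ P
map-load-++ xs ys P = trans (cong (_++ P) (map-++ load xs ys)) (++-assoc (map load xs) _ P)

replicate-load : ∀ t i (P : Program) → replicate t (load i) ++ P ≡ map load (replicate t i) ++ P
replicate-load t i P = cong (_++ P) (sym (map-replicate load t i))

length-range : ∀ k n → length (range k n) ≡ n
length-range k zero    = refl
length-range k (suc n) = cong suc (length-range (suc k) n)

module _ {A : Set} where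

  lookup-∷ʳ-fromℕ : ∀ {n} (xs : Vec A n) x → lookup (xs ∷ʳ x) (fromℕ n) ≡ x
  lookup-∷ʳ-fromℕ Vec.[]       x = refl
  lookup-∷ʳ-fromℕ (y Vec.∷ xs) x = lookup-∷ʳ-fromℕ xs x

  lookup-∷ʳ-inject₁ : ∀ {n} (xs : Vec A n) x i → lookup (xs ∷ʳ x) (inject₁ i) ≡ lookup xs i
  lookup-∷ʳ-inject₁ (y Vec.∷ xs) x zero    = refl
  lookup-∷ʳ-inject₁ (y Vec.∷ xs) x (suc i) = lookup-∷ʳ-inject₁ xs x i

module Translation (S : Addressing) where
  open Theory S

  ⊕-++ : ∀ X as bs → (X ⊕ as) ⊕ bs ≡ X ⊕ (as ++ bs)
  ⊕-++ X as bs = cong (λ t → mk (regs X) (prog X) t (valid X)) (++-assoc (tape X) as bs)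

  ⊕-identityʳ : ∀ X → X ⊕ [] ≡ X
  ⊕-identityʳ X = cong (λ t → mk (regs X) (prog X) t (valid X)) (++-identityʳ (tape X))

  foldl-·-code : ∀ X as → foldl _·_ (code X) as ≡ code (X ⊕ as)
  foldl-·-code X []       = cong code (sym (⊕-identityʳ X))
  foldl-·-code X (a ∷ as) = begin
    foldl _·_ (code (decode (code X) ⊕ (a ∷ []))) as ≡⟨ cong (λ Y → foldl _·_ (code (Y ⊕ (a ∷ []))) as) (decode∘code X) ⟩
    foldl _·_ (code (X ⊕ (a ∷ []))) as               ≡⟨ foldl-·-code (X ⊕ (a ∷ [])) as ⟩
    code ((X ⊕ (a ∷ [])) ⊕ as)                       ≡⟨ cong code (⊕-++ X (a ∷ []) as) ⟩
    code (X ⊕ (a ∷ as))                              ∎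
    where open ≡-Reasoning

  ≡ae-setoid : Setoid _ _
  ≡ae-setoid = record
    { Carrier       = 𝓜
    ; _≈_           = _≡ae_
    ; isEquivalence = record { refl = ae-refl ; sym = ae-sym ; trans = ae-trans }
    }

  ≡ae-++-[] : ∀ {X Y as bs} → X ⊕ (as ++ []) ≡ae Y ⊕ (bs ++ []) → X ⊕ as ≡ae Y ⊕ bs
  ≡ae-++-[] {X} {Y} {as} {bs} =
    subst₂ _≡ae_ (cong (X ⊕_) (++-identityʳ as)) (cong (Y ⊕_) (++-identityʳ bs))

  ⊕-cong : ∀ Z xs {y y′} ys → decode y ≡ae decode y′ → Z ⊕ (xs ++ y ∷ ys) ≡ae Z ⊕ (xs ++ y′ ∷ ys)
  ⊕-cong Z xs ys y≃y′ =
    ae-red ε ( Pointwise.refl (MaybePointwise.refl ae-refl)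
             , refl
             , Pointwise.++⁺ (same (tape Z)) (Pointwise.++⁺ (same xs) (y≃y′ Pointwise.∷ same ys)))
    where
    same : ∀ zs → Pointwise.Pointwise (λ a b → decode a ≡ae decode b) zs zs
    same zs = Pointwise.refl ae-refl

  is-just-setReg : ∀ R i a → map is-just (setReg R i (just a)) ≡ ins (map is-just R) i
  is-just-setReg []      i       a = refl
  is-just-setReg (r ∷ R) zero    a = refl
  is-just-setReg (r ∷ R) (suc i) a = cong (is-just r ∷_) (is-just-setReg R i a)

  lookupReg-setReg-≢ : ∀ R {i j} u → i ≢ j → lookupReg (setReg R i u) j ≡ lookupReg R j
  lookupReg-setReg-≢ []      u i≢j = refl
  lookupReg-setReg-≢ (r ∷ R) {zero}  {zero}  u i≢j = ⊥-elim (i≢j refl)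
  lookupReg-setReg-≢ (r ∷ R) {zero}  {suc j} u i≢j = refl
  lookupReg-setReg-≢ (r ∷ R) {suc i} {zero}  u i≢j = refl
  lookupReg-setReg-≢ (r ∷ R) {suc i} {suc j} u i≢j = lookupReg-setReg-≢ R u (λ i≡j → i≢j (cong suc i≡j))

  lookupReg-setReg-≡ : ∀ R i u {x} → lookupReg R i ≡ just x → lookupReg (setReg R i u) i ≡ u
  lookupReg-setReg-≡ (r ∷ R) zero    u e = refl
  lookupReg-setReg-≡ (r ∷ R) (suc i) u e = lookupReg-setReg-≡ R i u e

  setReg-setReg : ∀ R i u w → setReg (setReg R i u) i w ≡ setReg R i w
  setReg-setReg []      i       u w = refl
  setReg-setReg (r ∷ R) zero    u w = refl
  setReg-setReg (r ∷ R) (suc i) u w = cong (r ∷_) (setReg-setReg R i u w)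

  setReg-lookupReg : ∀ R i {x} → lookupReg R i ≡ just x → setReg R i (just x) ≡ R
  setReg-lookupReg (r ∷ R) zero    refl = refl
  setReg-lookupReg (r ∷ R) (suc i) e    = cong (r ∷_) (setReg-lookupReg R i e)

  lookupReg-++ˡ : ∀ as L {t} → t < length as → lookupReg (map just as ++ L) t ≡ lookupReg (map just as) t
  lookupReg-++ˡ (a ∷ as) L {zero}  lt       = refl
  lookupReg-++ˡ (a ∷ as) L {suc t} (s≤s lt) = lookupReg-++ˡ as L lt

  lookupReg-++ʳ : ∀ as L d → lookupReg (map just as ++ L) (d + length as) ≡ lookupReg L d
  lookupReg-++ʳ []       L d = cong (lookupReg L) (+-identityʳ d)
  lookupReg-++ʳ (a ∷ as) L d rewrite +-suc d (length as) = lookupReg-++ʳ as L d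

  setReg-++ʳ : ∀ as L d u → setReg (map just as ++ L) (d + length as) u ≡ map just as ++ setReg L d u
  setReg-++ʳ []       L d u = cong (λ i → setReg L i u) (+-identityʳ d)
  setReg-++ʳ (a ∷ as) L d u rewrite +-suc d (length as) = cong (just a ∷_) (setReg-++ʳ as L d u)

  -- Validity certificates are not determined by the reduction, so runs are
  -- specified by the registers, program and tape they reach.
  Reaches : 𝓜 → List (Maybe Addr) → Program → List Addr → Set
  Reaches M R P ts = Σ 𝓜 λ N → (M ↠h N) × (regs N ≡ R) × (prog N ≡ P) × (tape N ≡ ts)

  _⇝_ : 𝓜 → 𝓜 → Set
  M ⇝ Z = Reaches M (regs Z) (prog Z) (tape Z)

  ⇝⇒≡ae : ∀ {M Z} → M ⇝ Z → M ≡ae Z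
  ⇝⇒≡ae (_ , M↠N , refl , refl , refl) =
    ae-red M↠N (Pointwise.refl (MaybePointwise.refl ae-refl) , refl , Pointwise.refl ae-refl)

  reaches-refl : ∀ {R P ts v} → Reaches (mk R P ts v) R P ts
  reaches-refl = _ , ε , refl , refl , refl

  reaches-trans : ∀ {M R P ts R′ P′ ts′} →
    Reaches M R P ts → (∀ v → Reaches (mk R P ts v) R′ P′ ts′) → Reaches M R′ P′ ts′
  reaches-trans (mk _ _ _ v , M↠N , refl , refl , refl) continue with continue v
  ... | N′ , N↠N′ , eqs = N′ , M↠N ◅◅ N↠N′ , eqs

  reaches-regs : ∀ {M R R′ P ts} → R ≡ R′ → Reaches M R P ts → Reaches M R′ P ts
  reaches-regs refl r = r

  step-reaches : ∀ {M N} → M →h N → M ⇝ N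
  step-reaches s = _ , s ◅ ε , refl , refl , refl

  load-reaches : ∀ {R i P a ts} v → Reaches (mk R (load i ∷ P) (a ∷ ts) v) (setReg R i (just a)) P ts
  load-reaches {R} {i} {P} {a} v =
    step-reaches (loadStep {v′ = subst (λ I → T (validP I P)) (sym (is-just-setReg R i a)) v})

  app-reaches : ∀ {R i j k P ts a b} v → lookupReg R i ≡ just a → lookupReg R j ≡ just b →
    Reaches (mk R (app i j k ∷ P) ts v) (setReg R k (just (a · b))) P ts
  app-reaches {R} {k = k} {P} {a = a} {b} v Ri Rj =
    step-reaches (appStep {v′ = subst (λ I → T (validP I P)) (sym (is-just-setReg R k (a · b)))
                                      (validA-app _ P v)} Ri Rj)

  skipLoads-reaches : ∀ {k r P ts} (xs : Vec Addr k) v →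
    Reaches (mk (r ∷ []) (replicate k (load 1) ++ P) (toList xs ++ ts) v) (r ∷ []) P ts
  skipLoads-reaches Vec.[]       v = reaches-refl
  skipLoads-reaches (x Vec.∷ xs) v = reaches-trans (load-reaches v) (skipLoads-reaches xs)

  loads-reaches : ∀ B A k R rest P ts v → length A ≡ k → R ≡ map just A ++ replicate (length B) nothing ++ rest →
    Reaches (mk R (map load (range k (length B)) ++ P) (B ++ ts) v) (map just (A ++ B) ++ rest) P ts
  loads-reaches [] A k R rest P ts v _ R≡ =
    reaches-regs (trans R≡ (cong (λ A′ → map just A′ ++ rest) (sym (++-identityʳ A)))) reaches-refl
  loads-reaches (b ∷ B) A _ _ rest P ts v refl refl =
    reaches-trans (load-reaches v) λ v′ →
    reaches-regs (cong (λ A′ → map just A′ ++ rest) (++-assoc A (b ∷ []) B))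
      (loads-reaches B (A ++ b ∷ []) (suc (length A)) _ rest P ts v′
        (trans (length-++ A) (+-comm (length A) 1)) loaded)
    where
    loaded : setReg (map just A ++ nothing ∷ replicate (length B) nothing ++ rest) (length A) (just b)
             ≡ map just (A ++ b ∷ []) ++ replicate (length B) nothing ++ rest
    loaded = trans (setReg-++ʳ A _ 0 (just b))
               (trans (sym (++-assoc (map just A) (just b ∷ []) _))
                 (cong (_++ replicate (length B) nothing ++ rest) (sym (map-++ just A (b ∷ [])))))

  appFold-reaches : ∀ C k i x R P ts v → lookupReg R i ≡ just x →
    (∀ t → t < length C → lookupReg R (k + t) ≡ lookupReg (map just C) t) → k + length C ≤ i →
    Reaches (mk R (map (λ j → app i j i) (range k (length C)) ++ P) ts v)
            (setReg R i (just (foldl _·_ x C))) P ts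
  appFold-reaches []      k i x R P ts v Ri _ _ = reaches-regs (sym (setReg-lookupReg R i Ri)) reaches-refl
  appFold-reaches (c ∷ C) k i x R P ts v Ri RC k+C≤i =
    reaches-trans (app-reaches v Ri (subst (λ j → lookupReg R j ≡ just c) (+-identityʳ k) (RC 0 (s≤s z≤n)))) λ v′ →
    reaches-regs (setReg-setReg R i _ _)
      (appFold-reaches C (suc k) i (x · c) (setReg R i (just (x · c))) P ts v′
        (lookupReg-setReg-≡ R i _ Ri) RC′ (subst (_≤ i) (+-suc k (length C)) k+C≤i))
    where
    RC′ : ∀ t → t < length C → lookupReg (setReg R i (just (x · c))) (suc k + t) ≡ lookupReg (map just C) t
    RC′ t t<C = trans (lookupReg-setReg-≢ R _ (λ i≡ → <⇒≢ k+t<i (sym i≡)))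
                  (trans (cong (lookupReg R) (sym (+-suc k t))) (RC (suc t) (s≤s t<C)))
      where
      k+t<i : suc k + t < i
      k+t<i = ≤-trans (s≤s (subst (_≤ k + length C) (+-suc k t) (+-monoʳ-≤ k t<C)))
                      (subst (_≤ i) (+-suc k (length C)) k+C≤i)

  Apply-reaches : ∀ m as x y ts v → length as ≡ m →
    mk (replicate m nothing ++ just x ∷ just y ∷ nothing ∷ []) (Apply m) (as ++ ts) v
      ⇝ (decode (foldl _·_ x as · foldl _·_ y as) ⊕ ts)
  Apply-reaches _ as x y ts v refl =
    reaches-trans (loads-reaches as [] 0 _ input (appsPart n) ts v refl refl) λ v₁ →
    reaches-trans (reaches-regs (setReg-++ʳ as input 0 _)
      (appFold-reaches as 0 n x _ _ ts v₁ (lookupReg-++ʳ as input 0) (λ t → lookupReg-++ˡ as input) ≤-refl)) λ v₂ →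
    reaches-trans (reaches-regs (setReg-++ʳ as _ 1 _)
      (appFold-reaches as 0 (suc n) y _ _ ts v₂ (lookupReg-++ʳ as _ 1) (λ t → lookupReg-++ˡ as _) (n≤1+n n))) λ v₃ →
    reaches-trans (reaches-regs (setReg-++ʳ as _ 2 _)
      (app-reaches v₃ (lookupReg-++ʳ as _ 0) (lookupReg-++ʳ as _ 1))) λ v₄ →
    step-reaches (callStep {v = v₄} (lookupReg-++ʳ as _ 2))
    where
    n = length as
    input = just x ∷ just y ∷ nothing ∷ []

  var-reaches : ∀ {m} (as : Vec Addr m) (i : Fin m) ts v →
    mk (nothing ∷ []) (replicate (toℕ i) (load 1) ++ load 0 ∷ replicate (m ∸ suc (toℕ i)) (load 1) ++ call 0 ∷ [])
       (toList as ++ ts) v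
      ⇝ (decode (lookup as i) ⊕ ts)
  var-reaches (a Vec.∷ as) zero    ts v =
    reaches-trans (load-reaches v) λ v₁ →
    reaches-trans (skipLoads-reaches as v₁) λ v₂ →
    step-reaches (callStep {v = v₂} refl)
  var-reaches (a Vec.∷ as) (suc i) ts v = reaches-trans (load-reaches v) (var-reaches as i ts)

  ⟦var⟧-unfold : ∀ {m} (as : Vec Addr m) (i : Fin m) ts → ⟦ var i ⟧ ⊕ (toList as ++ ts) ≡ae decode (lookup as i) ⊕ ts
  ⟦var⟧-unfold as i ts = ⇝⇒≡ae (var-reaches as i ts _)

  ⟦cst⟧-unfold : ∀ {m} a (as : Vec Addr m) ts → ⟦ cst {m} a ⟧ ⊕ (toList as ++ ts) ≡ae decode a ⊕ ts
  ⟦cst⟧-unfold a as ts = ⇝⇒≡ae (reaches-trans (skipLoads-reaches as _) λ v → step-reaches (callStep {v = v} refl))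

  ⟦var∣cst⟧-unfold : ∀ {k} (x : Fin k ⊎ Addr) (bs : Vec Addr k) ts →
    ⟦ [ var , cst ]′ x ⟧ ⊕ (toList bs ++ ts) ≡ae decode ([ lookup bs , id ]′ x) ⊕ ts
  ⟦var∣cst⟧-unfold (inj₁ j) bs ts = ⟦var⟧-unfold bs j ts
  ⟦var∣cst⟧-unfold (inj₂ a) bs ts = ⟦cst⟧-unfold a bs ts

  ⟦$⟧-unfold : ∀ {m} (M N : Tm m) (as : Vec Addr m) ts →
    ⟦ M $ N ⟧ ⊕ (toList as ++ ts) ≡ae ⟦ M ⟧ ⊕ (toList as ++ code (⟦ N ⟧ ⊕ toList as) ∷ ts)
  ⟦$⟧-unfold {m} M N as ts =
    subst (⟦ M $ N ⟧ ⊕ (toList as ++ ts) ≡ae_) jump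
      (⇝⇒≡ae (Apply-reaches m (toList as) _ _ ts _ (length-toList as)))
    where
    open ≡-Reasoning
    y = code (⟦ N ⟧ ⊕ toList as)
    jump : decode (foldl _·_ (code ⟦ M ⟧) (toList as) · foldl _·_ (code ⟦ N ⟧) (toList as)) ⊕ ts
           ≡ ⟦ M ⟧ ⊕ (toList as ++ y ∷ ts)
    jump = begin
      decode (foldl _·_ (code ⟦ M ⟧) (toList as) · foldl _·_ (code ⟦ N ⟧) (toList as)) ⊕ ts
        ≡⟨ cong₂ (λ x x′ → decode (x · x′) ⊕ ts) (foldl-·-code ⟦ M ⟧ _) (foldl-·-code ⟦ N ⟧ _) ⟩
      decode (code (decode (code (⟦ M ⟧ ⊕ toList as)) ⊕ (y ∷ []))) ⊕ ts
        ≡⟨ cong (_⊕ ts) (decode∘code _) ⟩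
      (decode (code (⟦ M ⟧ ⊕ toList as)) ⊕ (y ∷ [])) ⊕ ts
        ≡⟨ cong (λ X → (X ⊕ (y ∷ [])) ⊕ ts) (decode∘code _) ⟩
      ((⟦ M ⟧ ⊕ toList as) ⊕ (y ∷ [])) ⊕ ts
        ≡⟨ ⊕-++ (⟦ M ⟧ ⊕ toList as) (y ∷ []) ts ⟩
      (⟦ M ⟧ ⊕ toList as) ⊕ (y ∷ ts)
        ≡⟨ ⊕-++ ⟦ M ⟧ (toList as) (y ∷ ts) ⟩
      ⟦ M ⟧ ⊕ (toList as ++ y ∷ ts)
        ∎

  ⟦⟧-loadPrefix : ∀ n (M : Tm n) → Σ (List ℕ) λ is → Σ Program λ P →
    (length is ≡ n) × (prog ⟦ M ⟧ ≡ map load is ++ P) × (tape ⟦ M ⟧ ≡ [])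
  ⟦⟧-loadPrefix n (var i) = replicate t 1 ++ 0 ∷ replicate q 1 , call 0 ∷ [] , length≡n , prog≡ , refl
    where
    t = toℕ i
    q = n ∸ suc t
    length≡n : length (replicate t 1 ++ 0 ∷ replicate q 1) ≡ n
    length≡n = trans (length-++ (replicate t 1))
                 (trans (cong₂ _+_ (length-replicate t) (cong suc (length-replicate q)))
                   (trans (+-suc t q) (m+[n∸m]≡n (toℕ<n i))))
    prog≡ : replicate t (load 1) ++ load 0 ∷ replicate q (load 1) ++ call 0 ∷ []
            ≡ map load (replicate t 1 ++ 0 ∷ replicate q 1) ++ call 0 ∷ []
    prog≡ = trans (replicate-load t 1 _)
              (trans (cong (λ P → map load (replicate t 1) ++ load 0 ∷ P) (replicate-load q 1 _))
                (sym (map-load-++ (replicate t 1) _ _)))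
  ⟦⟧-loadPrefix n (cst a) = replicate n 1 , call 0 ∷ [] , length-replicate n , replicate-load n 1 _ , refl
  ⟦⟧-loadPrefix n (M $ N) = range 0 n , appsPart n , length-range 0 n , refl , refl
  ⟦⟧-loadPrefix n (lam M) with ⟦⟧-loadPrefix (suc n) M
  ... | is , P , length≡ , prog≡ , tape≡ =
    take n is , map load (drop n is) ++ P ,
    trans (length-take n is) (trans (cong (n ⊓_) length≡) (m≤n⇒m⊓n≡m (n≤1+n n))) ,
    trans prog≡ (trans (cong (λ is′ → map load is′ ++ P) (sym (take++drop≡id n is))) (map-load-++ (take n is) _ P)) ,
    tape≡

  loadPrefix-stuck : ∀ (X : 𝓜) is P → prog X ≡ map load is ++ P → length (tape X) < length is → X ↠stuck
  loadPrefix-stuck (mk R _ []       v) (i ∷ is) P refl _          = _ , ε , i , map load is ++ P , refl , refl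
  loadPrefix-stuck (mk R _ (a ∷ ts) v) (i ∷ is) P refl (s≤s ts<is)
    with loadPrefix-stuck (mk (setReg R i (just a)) (map load is ++ P) ts
                             (subst (λ I → T (validP I (map load is ++ P))) (sym (is-just-setReg R i a)) v))
                          is P refl ts<is
  ... | N , N′↠N , N-stuck = N , loadStep ◅ N′↠N , N-stuck

  StuckBelow : ℕ → 𝓜 → Set
  StuckBelow p X = ∀ ds → length ds < p → (X ⊕ ds) ↠stuck

  ⟦⟧-stuckBelow : ∀ {n} (M : Tm n) → StuckBelow n ⟦ M ⟧
  ⟦⟧-stuckBelow {n} M ds ds<n with ⟦⟧-loadPrefix n M
  ... | is , P , length≡ , prog≡ , tape≡ =
    loadPrefix-stuck (⟦ M ⟧ ⊕ ds) is P prog≡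
      (subst₂ _<_ (sym (cong (λ t → length (t ++ ds)) tape≡)) (sym length≡) ds<n)

  stuckBelow-⊕ : ∀ {p X} a → StuckBelow (suc p) X → StuckBelow p (X ⊕ (a ∷ []))
  stuckBelow-⊕ {X = X} a X-stuck ds ds<p =
    subst _↠stuck (sym (⊕-++ X (a ∷ []) ds)) (X-stuck (a ∷ ds) (s≤s ds<p))

  ≡ae-ext : ∀ p {X Y} → StuckBelow p X → StuckBelow p Y →
    (∀ (cs : Vec Addr p) → X ⊕ toList cs ≡ae Y ⊕ toList cs) → X ≡ae Y
  ≡ae-ext zero {X} {Y} _ _ X≡Y = subst₂ _≡ae_ (⊕-identityʳ X) (⊕-identityʳ Y) (X≡Y Vec.[])
  ≡ae-ext (suc p) {X} {Y} X-stuck Y-stuck X≡Y =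
    ae-stuck (stuck X X-stuck) (stuck Y Y-stuck) λ a →
    ≡ae-ext p (stuckBelow-⊕ a X-stuck) (stuckBelow-⊕ a Y-stuck) λ cs →
    subst₂ _≡ae_ (sym (⊕-++ X (a ∷ []) (toList cs))) (sym (⊕-++ Y (a ∷ []) (toList cs))) (X≡Y (a Vec.∷ cs))
    where
    stuck : ∀ Z → StuckBelow (suc p) Z → Z ↠stuck
    stuck Z Z-stuck = subst _↠stuck (⊕-identityʳ Z) (Z-stuck [] (s≤s z≤n))

  ≡ae-extendTape : ∀ {X Y xs ys} → (X ⊕ xs) ↠stuck → (Y ⊕ ys) ↠stuck →
    (∀ a ts → X ⊕ (xs ++ a ∷ ts) ≡ae Y ⊕ (ys ++ a ∷ ts)) → ∀ ts → X ⊕ (xs ++ ts) ≡ae Y ⊕ (ys ++ ts)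
  ≡ae-extendTape _ _ X≡Y (a ∷ ts) = X≡Y a ts
  ≡ae-extendTape {X} {Y} {xs} {ys} X-stuck Y-stuck X≡Y [] =
    subst₂ _≡ae_ (cong (X ⊕_) (sym (++-identityʳ xs))) (cong (Y ⊕_) (sym (++-identityʳ ys)))
      (ae-stuck X-stuck Y-stuck λ a →
        subst₂ _≡ae_ (sym (⊕-++ X xs (a ∷ []))) (sym (⊕-++ Y ys (a ∷ []))) (X≡Y a []))

  Compatible : ∀ {m k} → (Fin m → Fin k ⊎ Addr) → Vec Addr m → Vec Addr k → Set
  Compatible θ as bs = ∀ i → lookup as i ≡ [ lookup bs , id ]′ (θ i)

  compatible-lift : ∀ {m k} (θ : Fin m → Fin k ⊎ Addr) as bs → Compatible θ as bs →
    ∀ a → Compatible (liftθ θ) (as ∷ʳ a) (bs ∷ʳ a)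
  compatible-lift {m} {k} θ as bs compat a i with m ≟ toℕ i
  ... | yes m≡i = begin
    lookup (as ∷ʳ a) i          ≡⟨ cong (lookup (as ∷ʳ a)) (toℕ-injective (trans (sym m≡i) (sym (toℕ-fromℕ m)))) ⟩
    lookup (as ∷ʳ a) (fromℕ m)  ≡⟨ lookup-∷ʳ-fromℕ as a ⟩
    a                           ≡⟨ lookup-∷ʳ-fromℕ bs a ⟨
    lookup (bs ∷ʳ a) (fromℕ k)  ∎
    where open ≡-Reasoning
  ... | no m≢i = begin
    lookup (as ∷ʳ a) i                      ≡⟨ cong (lookup (as ∷ʳ a)) (inject₁-lower₁ i m≢i) ⟨
    lookup (as ∷ʳ a) (inject₁ j)            ≡⟨ lookup-∷ʳ-inject₁ as a j ⟩
    lookup as j                             ≡⟨ compat j ⟩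
    [ lookup bs , id ]′ (θ j)               ≡⟨ lookup-inject₁ (θ j) ⟩
    [ lookup (bs ∷ʳ a) , id ]′ (Sum.map₁ inject₁ (θ j)) ∎
    where
    open ≡-Reasoning
    j = lower₁ i m≢i
    lookup-inject₁ : ∀ x → [ lookup bs , id ]′ x ≡ [ lookup (bs ∷ʳ a) , id ]′ (Sum.map₁ inject₁ x)
    lookup-inject₁ (inj₁ l) = sym (lookup-∷ʳ-inject₁ bs a l)
    lookup-inject₁ (inj₂ c) = refl

  ⊕-∷ʳ : ∀ {m} X (as : Vec Addr m) a ts → X ⊕ (toList (as ∷ʳ a) ++ ts) ≡ X ⊕ (toList as ++ a ∷ ts)
  ⊕-∷ʳ X as a ts = cong (X ⊕_) (trans (cong (_++ ts) (toList-∷ʳ a as)) (++-assoc (toList as) (a ∷ []) ts))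

  ⟦⟧-act : ∀ {m k} (M : Tm m) (θ : Fin m → Fin k ⊎ Addr) as bs → Compatible θ as bs →
    ∀ ts → ⟦ M ⟧ ⊕ (toList as ++ ts) ≡ae ⟦ act θ M ⟧ ⊕ (toList bs ++ ts)
  ⟦⟧-act (var i) θ as bs compat ts = begin
    ⟦ var i ⟧ ⊕ (toList as ++ ts)                ≈⟨ ⟦var⟧-unfold as i ts ⟩
    decode (lookup as i) ⊕ ts                    ≡⟨ cong (λ a → decode a ⊕ ts) (compat i) ⟩
    decode ([ lookup bs , id ]′ (θ i)) ⊕ ts      ≈⟨ ⟦var∣cst⟧-unfold (θ i) bs ts ⟨
    ⟦ [ var , cst ]′ (θ i) ⟧ ⊕ (toList bs ++ ts) ∎
    where open import Relation.Binary.Reasoning.Setoid ≡ae-setoid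
  ⟦⟧-act (cst a) θ as bs compat ts = ae-trans (⟦cst⟧-unfold a as ts) (ae-sym (⟦cst⟧-unfold a bs ts))
  ⟦⟧-act (M $ N) θ as bs compat ts = begin
    ⟦ M $ N ⟧ ⊕ (toList as ++ ts)
      ≈⟨ ⟦$⟧-unfold M N as ts ⟩
    ⟦ M ⟧ ⊕ (toList as ++ code (⟦ N ⟧ ⊕ toList as) ∷ ts)
      ≈⟨ ⟦⟧-act M θ as bs compat _ ⟩
    ⟦ act θ M ⟧ ⊕ (toList bs ++ code (⟦ N ⟧ ⊕ toList as) ∷ ts)
      ≈⟨ ⊕-cong ⟦ act θ M ⟧ (toList bs) ts (subst₂ _≡ae_ (sym (decode∘code _)) (sym (decode∘code _))
                                           (≡ae-++-[] {⟦ N ⟧} {⟦ act θ N ⟧} (⟦⟧-act N θ as bs compat []))) ⟩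
    ⟦ act θ M ⟧ ⊕ (toList bs ++ code (⟦ act θ N ⟧ ⊕ toList bs) ∷ ts)
      ≈⟨ ⟦$⟧-unfold (act θ M) (act θ N) bs ts ⟨
    ⟦ act θ M $ act θ N ⟧ ⊕ (toList bs ++ ts)
      ∎
    where open import Relation.Binary.Reasoning.Setoid ≡ae-setoid
  ⟦⟧-act (lam M) θ as bs compat =
    ≡ae-extendTape {⟦ M ⟧} {⟦ act (liftθ θ) M ⟧} (stuck M as) (stuck (act (liftθ θ) M) bs) λ a ts →
    subst₂ _≡ae_ (⊕-∷ʳ ⟦ M ⟧ as a ts) (⊕-∷ʳ ⟦ act (liftθ θ) M ⟧ bs a ts)
      (⟦⟧-act M (liftθ θ) (as ∷ʳ a) (bs ∷ʳ a) (compatible-lift θ as bs compat a) ts)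
    where
    stuck : ∀ {n} (M′ : Tm (suc n)) (cs : Vec Addr n) → (⟦ M′ ⟧ ⊕ toList cs) ↠stuck
    stuck M′ cs = ⟦⟧-stuckBelow M′ (toList cs) (s≤s (≤-reflexive (length-toList cs)))

  ⟦⟧-act-closed : ∀ {m k} (M : Tm m) (θ : Fin m → Fin k ⊎ Addr) as bs → Compatible θ as bs →
    ⟦ M ⟧ ⊕ toList as ≡ae ⟦ act θ M ⟧ ⊕ toList bs
  ⟦⟧-act-closed M θ as bs compat = ≡ae-++-[] {⟦ M ⟧} {⟦ act θ M ⟧} (⟦⟧-act M θ as bs compat [])

  ⟦⟧-stuck-take : ∀ n (M : Tm n) (as : Vec Addr n) m → m < n → (⟦ M ⟧ ⊕ take m (toList as)) ↠stuck
  ⟦⟧-stuck-take n M as m m<n =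
    ⟦⟧-stuckBelow M _ (≤-<-trans (≤-trans (≤-reflexive (length-take m (toList as))) (m⊓n≤m m _)) m<n)

  ⟦⟧-[0:=] : ∀ n (M : Tm (suc n)) b → ⟦ M ⟧ ⊕ (b ∷ []) ≡ae ⟦ M [0:= b ] ⟧
  ⟦⟧-[0:=] n M b = ≡ae-ext n (stuckBelow-⊕ b (⟦⟧-stuckBelow M)) (⟦⟧-stuckBelow (M [0:= b ])) λ cs →
    subst (_≡ae ⟦ M [0:= b ] ⟧ ⊕ toList cs) (sym (⊕-++ ⟦ M ⟧ (b ∷ []) (toList cs)))
      (⟦⟧-act-closed M _ (b Vec.∷ cs) cs λ { zero → refl ; (suc i) → refl })

  ⟦⟧-weaken0 : ∀ n (M : Tm n) b → ⟦ weaken0 M ⟧ ⊕ (b ∷ []) ≡ae ⟦ M ⟧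
  ⟦⟧-weaken0 n M b = ≡ae-ext n (stuckBelow-⊕ b (⟦⟧-stuckBelow (weaken0 M))) (⟦⟧-stuckBelow M) λ cs →
    subst (_≡ae ⟦ M ⟧ ⊕ toList cs) (sym (⊕-++ ⟦ weaken0 M ⟧ (b ∷ []) (toList cs)))
      (ae-sym (⟦⟧-act-closed M _ cs (b Vec.∷ cs) λ i → refl))

  ⟦⟧-permute : ∀ n (M : Tm n) (as : Vec Addr n) (σ : Permutation′ n) →
    ⟦ M ⟧ ⊕ toList as ≡ae ⟦ rename (σ ⟨$⟩ˡ_) M ⟧ ⊕ toList (tabulate (λ j → lookup as (σ ⟨$⟩ʳ j)))
  ⟦⟧-permute n M as σ = ⟦⟧-act-closed M _ as _ λ i →
    sym (trans (lookup∘tabulate _ (σ ⟨$⟩ˡ i)) (cong (lookup as) (inverseʳ σ)))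

lemma4p8 : (S : Addressing) → let open Theory S in
  -- (i)
  (∀ n (M : Tm n) → Σ (List ℕ) λ is → Σ Program λ P →
      (length is ≡ n) × (prog ⟦ M ⟧ ≡ map load is ++ P) × (tape ⟦ M ⟧ ≡ []))
  -- (ii)
  × (∀ n (M : Tm n) (as : Vec Addr n) (m : ℕ) → m < n →
      (⟦ M ⟧ ⊕ take m (toList as)) ↠stuck)
  -- (iii)
  × (∀ n (M : Tm (suc n)) (b : Addr) →
      (⟦ M ⟧ ⊕ (b ∷ [])) ≡ae ⟦ M [0:= b ] ⟧)
  -- (iv)
  × (∀ n (M : Tm n) (b : Addr) →
      (⟦ weaken0 M ⟧ ⊕ (b ∷ [])) ≡ae ⟦ M ⟧)
  -- (v)
  × (∀ n (M : Tm n) (as : Vec Addr n) (σ : Permutation′ n) →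
      (⟦ M ⟧ ⊕ toList as)
        ≡ae (⟦ rename (σ ⟨$⟩ˡ_) M ⟧ ⊕ toList (tabulate (λ j → lookup as (σ ⟨$⟩ʳ j)))))
lemma4p8 S = ⟦⟧-loadPrefix , ⟦⟧-stuck-take , ⟦⟧-[0:=] , ⟦⟧-weaken0 , ⟦⟧-permute
  where open Translation S
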